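{- Let $G$ and $H$ be connected graphs with at least two vertices, of orders $n_1$ and $n_2$ respectively. If $G_{SR}$ is a $\mathcal{C}$-graph, then $$dim_s(G\boxtimes H)=n_2\cdot dim_s(G)+n_1\cdot dim_s(H)-dim_s(G)\cdot dim_s(H).$$
   Context: All graphs are finite and simple; $d_G$ is shortest-path distance and $\beta(X)$ the independence number. A vertex $w$ strongly resolves $u,v$ if $d_G(w,u)=d_G(w,v)+d_G(v,u)$ or $d_G(w,v)=d_G(w,u)+d_G(u,v)$; $dim_s(G)$ is the minimum size of a set $S\subseteq V(G)$ such that every pair of vertices is strongly resolved by some vertex of $S$. A vertex $u$ is maximally distant from $v$ if $d_G(v,w)\le d_G(u,v)$ for every neighbour $w$ of $u$; $u,v$ are mutually maximally distant if each is maximally distant from the other. $G_{SR}$ is the graph on $V(G)$ in which $u,v$ are adjacent iff they are mutually maximally distant in $G$. A $\mathcal{C}$-graph is a graph $X$ whose vertex set can be partitioned into exactly $\beta(X)$ cliques. The strong product $G\boxtimes H$ has vertex set $V(G)\times V(H)$, with $(a,b)\sim(c,d)$ iff ($a=c$ and $bd\in E(H)$) or ($ac\in E(G)$ and $b=d$) or ($ac\in E(G)$ and $bd\in E(H)$). -}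

module Defs where

open import Data.Nat using (ℕ; zero; suc; _+_; _*_; _≤_; _<_)
open import Data.Fin using (Fin; remQuot)
open import Data.Fin.Subset using (Subset; _∈_; ∣_∣)
open import Data.Product using (Σ; ∃; ∃-syntax; _×_; _,_; proj₁; proj₂)
open import Data.Sum using (_⊎_; inj₁; inj₂)
open import Data.Empty using (⊥)
open import Function using (Surjective)
open import Relation.Nullary using (¬_)
open import Relation.Binary.PropositionalEquality using (_≡_; _≢_; refl; sym)

record Graph : Set₁ where
  field
    n     : ℕ
    Adj   : Fin n → Fin n → Set
    adj-sym : ∀ {u v} → Adj u v → Adj v u
    irref : ∀ {u} → ¬ Adj u u
open Graph public

data Walk (G : Graph) : Fin (n G) → Fin (n G) → ℕ → Set where
  here : ∀ {u} → Walk G u u 0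
  step : ∀ {u v w k} → Adj G u v → Walk G v w k → Walk G u w (suc k)

Dist : (G : Graph) → Fin (n G) → Fin (n G) → ℕ → Set
Dist G u v k = Walk G u v k × (∀ j → Walk G u v j → k ≤ j)

Connected : Graph → Set
Connected G = ∀ u v → ∃[ k ] Walk G u v k

StronglyResolves : (G : Graph) → Fin (n G) → Fin (n G) → Fin (n G) → Set
StronglyResolves G w u v =
  ∃[ a ] ∃[ b ] ∃[ c ] (Dist G w u a × Dist G w v b × Dist G u v c ×
    ((a ≡ b + c) ⊎ (b ≡ a + c)))

StrongResolvingSet : (G : Graph) → Subset (n G) → Set
StrongResolvingSet G S = ∀ u v → ∃[ w ] (w ∈ S × StronglyResolves G w u v)

IsStrongMetricDim : Graph → ℕ → Set
IsStrongMetricDim G k =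
  (∃[ S ] (StrongResolvingSet G S × ∣ S ∣ ≡ k)) ×
  (∀ S → StrongResolvingSet G S → k ≤ ∣ S ∣)

MaxDistant : (G : Graph) → Fin (n G) → Fin (n G) → Set
MaxDistant G u v = ∀ w a b → Adj G u w → Dist G v w a → Dist G u v b → a ≤ b

MutuallyMaxDistant : (G : Graph) → Fin (n G) → Fin (n G) → Set
MutuallyMaxDistant G u v = MaxDistant G u v × MaxDistant G v u

SR : Graph → Graph
SR G = record
  { n = n G
  ; Adj = λ u v → u ≢ v × MutuallyMaxDistant G u v
  ; adj-sym = λ { (ne , p , q) → (λ e → ne (sym e)) , q , p }
  ; irref = λ { (ne , _) → ne refl }
  }

IndependentSet : (X : Graph) → Subset (n X) → Set
IndependentSet X S = ∀ u v → u ∈ S → v ∈ S → ¬ Adj X u v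

IsIndependenceNumber : Graph → ℕ → Set
IsIndependenceNumber X k =
  (∃[ S ] (IndependentSet X S × ∣ S ∣ ≡ k)) ×
  (∀ S → IndependentSet X S → ∣ S ∣ ≤ k)

-- Partition of V(X) into exactly k (nonempty) cliques: the surjective map
-- c assigns each vertex its block; each block is a clique.
CliquePartition : (X : Graph) → ℕ → Set
CliquePartition X k =
  Σ (Fin (n X) → Fin k) λ c →
    Surjective _≡_ _≡_ c × (∀ u v → c u ≡ c v → u ≢ v → Adj X u v)

IsCGraph : Graph → Set
IsCGraph X = ∃[ k ] (IsIndependenceNumber X k × CliquePartition X k)

-- strong product, vertex (a , b) encoded by combine a b : Fin (n1 * n2)
StrongAdj : (G H : Graph) → Fin (n G * n H) → Fin (n G * n H) → Set
StrongAdj G H x y =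
  let a = proj₁ (remQuot {n G} (n H) x) ; b = proj₂ (remQuot {n G} (n H) x)
      c = proj₁ (remQuot {n G} (n H) y) ; d = proj₂ (remQuot {n G} (n H) y)
  in (a ≡ c × Adj H b d) ⊎ (Adj G a c × b ≡ d) ⊎ (Adj G a c × Adj H b d)

_⊠_ : Graph → Graph → Graph
G ⊠ H = record
  { n = n G * n H
  ; Adj = StrongAdj G H
  ; adj-sym = λ { (inj₁ (e , p)) → inj₁ (sym e , adj-sym H p)
            ; (inj₂ (inj₁ (p , e))) → inj₂ (inj₁ (adj-sym G p , sym e))
            ; (inj₂ (inj₂ (p , q))) → inj₂ (inj₂ (adj-sym G p , adj-sym H q)) }
  ; irref = λ { (inj₁ (_ , p)) → irref H p
              ; (inj₂ (inj₁ (p , _))) → irref G p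
              ; (inj₂ (inj₂ (p , _))) → irref G p }
  }

-- 1. (Oellermann–Peters-Fransen) A vertex set is strongly resolving iff it
--    meets every edge of the strong resolving graph X_SR.  For the hard
--    direction, a longest geodesic x … u … v … y through u and v has mutually
--    maximally distant ends, one of which lies in the set and resolves u, v.
--    So complements of strong resolving sets are the independent sets of
--    X_SR, and dim_s(X) + β(X_SR) = n  (dim+β≡n).
-- 2. Distances in G ⊠ H are maxima of coordinate distances.  Hence edges of
--    (G ⊠ H)_SR project to edges of G_SR or H_SR (SR-project), and coordinates
--    that are equal or mutually maximally distant lift (SR-lift).
-- 3. Products of independent sets are independent; conversely, cutting V(G)
--    into β(G_SR) cliques of G_SR, every independent set of (G ⊠ H)_SR is at
--    most β(G_SR) · β(H_SR) large.  So β((G ⊠ H)_SR) = β(G_SR) · β(H_SR) (β-⊠).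
-- 4. The theorem is 1 applied to G, H and G ⊠ H, combined by arithmetic.
-- Distances are read off the given strong resolving sets, which record
-- d(u, v) for every pair.
module Submission where

open import Defs
open import Data.Nat using (ℕ; zero; suc; _+_; _*_; _∸_; _≤_; _<_; _⊔_; z≤n; s≤s; _≤?_)
open import Data.Nat.Properties
open import Data.Fin using (Fin; zero; suc; remQuot; combine; _↑ˡ_; _↑ʳ_)
open import Data.Fin.Properties
  using (any?; remQuot-combine; combine-remQuot; combine-injectiveˡ; combine-injectiveʳ)
  renaming (_≟_ to _≟ᶠ_; suc-injective to fsuc-injective; 0≢1+n to fzero≢fsuc)
open import Data.Fin.Subset using (Subset; _∈_; ∣_∣; ∁; inside; outside)
open import Data.Fin.Subset.Properties using (_∈?_; drop-there; x∈∁p⇒x∉p; x∉p⇒x∈∁p; ∣∁p∣≡n∸∣p∣; ∣p∣≤n)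
open import Data.Vec using (_∷_; []; lookup; tabulate; there)
open import Data.Vec.Properties using (lookup∘tabulate; []=⇒lookup; lookup⇒[]=)
open import Data.Product using (Σ; ∃-syntax; _×_; _,_; proj₁; proj₂)
open import Data.Sum using (_⊎_; inj₁; inj₂; [_,_]′; map₂)
open import Data.List using (List; filter; cartesianProduct; allFin)
import Data.List.Relation.Unary.All as All
open import Data.List.Relation.Unary.All.Properties using (all-filter)
open import Data.List.Membership.Propositional.Properties using (∈-filter⁺; ∈-cartesianProduct⁺; ∈-allFin)
open import Data.List.Extrema.Nat using (argmax; argmax-all; f[xs]≤f[argmax])
open import Data.Empty using (⊥-elim)
open import Relation.Nullary using (¬_; Dec; yes; no; does)
open import Relation.Nullary.Decidable using (_×-dec_; dec-true)
open import Relation.Binary.PropositionalEquality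
open import Data.Nat.Tactic.RingSolver using (solve-∀)
open import Algebra.Properties.Semiring.Sum +-*-semiring
  using (sum; sum-syntax; sum-cong-≗; ∑-comm; *-distribˡ-sum; *-distribʳ-sum)

sum-mono-≤ : ∀ {n} {f g : Fin n → ℕ} → (∀ i → f i ≤ g i) → sum f ≤ sum g
sum-mono-≤ {zero}  f≤g = z≤n
sum-mono-≤ {suc n} f≤g = +-mono-≤ (f≤g zero) (sum-mono-≤ (λ i → f≤g (suc i)))

sum-const : ∀ n c → ∑[ i < n ] c ≡ n * c
sum-const zero    c = refl
sum-const (suc n) c = cong (c +_) (sum-const n c)

sum-zero : ∀ {n} {f : Fin n → ℕ} → (∀ i → f i ≡ 0) → sum f ≡ 0
sum-zero {zero}  f≡0 = refl
sum-zero {suc n} f≡0 = cong₂ _+_ (f≡0 zero) (sum-zero (λ i → f≡0 (suc i)))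

sum-split : ∀ m n (f : Fin (m + n) → ℕ) →
  sum f ≡ ∑[ i < m ] f (i ↑ˡ n) + ∑[ j < n ] f (m ↑ʳ j)
sum-split zero    n f = refl
sum-split (suc m) n f =
  trans (cong (f zero +_) (sum-split m n (λ i → f (suc i)))) (sym (+-assoc (f zero) _ _))

sum-combine : ∀ m n (f : Fin (m * n) → ℕ) →
  sum f ≡ ∑[ a < m ] ∑[ b < n ] f (combine a b)
sum-combine zero    n f = refl
sum-combine (suc m) n f =
  trans (sum-split n (m * n) f)
        (cong (∑[ b < n ] f (combine {suc m} zero b) +_) (sum-combine m n (λ x → f (n ↑ʳ x))))

𝟙 : ∀ {a} {A : Set a} → Dec A → ℕ
𝟙 (yes _) = 1
𝟙 (no _)  = 0

𝟙-⇔ : ∀ {a b} {A : Set a} {B : Set b} → (A → B) → (B → A) →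
  (a? : Dec A) (b? : Dec B) → 𝟙 a? ≡ 𝟙 b?
𝟙-⇔ f g (yes a) (yes b) = refl
𝟙-⇔ f g (yes a) (no ¬b) = ⊥-elim (¬b (f a))
𝟙-⇔ f g (no ¬a) (yes b) = ⊥-elim (¬a (g b))
𝟙-⇔ f g (no ¬a) (no ¬b) = refl

𝟙-× : ∀ {a b} {A : Set a} {B : Set b} (a? : Dec A) (b? : Dec B) →
  𝟙 (a? ×-dec b?) ≡ 𝟙 a? * 𝟙 b?
𝟙-× (yes a) (yes b) = refl
𝟙-× (yes a) (no ¬b) = refl
𝟙-× (no ¬a) b?      = refl

𝟙-no : ∀ {a} {A : Set a} → ¬ A → (a? : Dec A) → 𝟙 a? ≡ 0
𝟙-no ¬a (yes a) = ⊥-elim (¬a a)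
𝟙-no ¬a (no _)  = refl

sum-𝟙≡ : ∀ {k} (s : Fin k) → ∑[ t < k ] 𝟙 (s ≟ᶠ t) ≡ 1
sum-𝟙≡ {suc k} zero = cong suc (sum-zero {k} (λ t → 𝟙-no (λ ()) (zero ≟ᶠ suc t)))
sum-𝟙≡ {suc k} (suc s) = trans (sum-cong-≗ (λ t → 𝟙-⇔ fsuc-injective (cong suc) (suc s ≟ᶠ suc t) (s ≟ᶠ t)))
                               (sum-𝟙≡ s)

sum-fibres : ∀ {n k} (c : Fin n → Fin k) (f : Fin n → ℕ) →
  sum f ≡ ∑[ t < k ] ∑[ a < n ] (𝟙 (c a ≟ᶠ t) * f a)
sum-fibres {n} {k} c f = begin
  ∑[ a < n ] f a                                   ≡⟨ sum-cong-≗ (λ a → sym (*-identityˡ (f a))) ⟩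
  ∑[ a < n ] (1 * f a)                             ≡⟨ sum-cong-≗ (λ a → cong (_* f a) (sym (sum-𝟙≡ (c a)))) ⟩
  ∑[ a < n ] (∑[ t < k ] 𝟙 (c a ≟ᶠ t) * f a)       ≡⟨ sum-cong-≗ (λ a → *-distribʳ-sum (f a) (λ t → 𝟙 (c a ≟ᶠ t))) ⟩
  ∑[ a < n ] ∑[ t < k ] (𝟙 (c a ≟ᶠ t) * f a)       ≡⟨ ∑-comm (λ a t → 𝟙 (c a ≟ᶠ t) * f a) ⟩
  ∑[ t < k ] ∑[ a < n ] (𝟙 (c a ≟ᶠ t) * f a)       ∎
  where open ≡-Reasoning

count-atMostOne : ∀ {n b} {P : Fin n → Set} {B : Set b} (P? : ∀ i → Dec (P i)) (B? : Dec B) →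
  (∀ i → P i → B) → (∀ i j → P i → P j → i ≡ j) → ∑[ i < n ] 𝟙 (P? i) ≤ 𝟙 B?
count-atMostOne {zero} P? B? witness unique = z≤n
count-atMostOne {suc n} {P = P} P? B? witness unique = split (P? zero)
  where
  open ≤-Reasoning
  unique-suc : ∀ i j → P (suc i) → P (suc j) → i ≡ j
  unique-suc i j pᵢ pⱼ = fsuc-injective (unique _ _ pᵢ pⱼ)

  split : (p₀? : Dec (P zero)) → 𝟙 p₀? + ∑[ i < n ] 𝟙 (P? (suc i)) ≤ 𝟙 B?
  split (no _)   = count-atMostOne (λ i → P? (suc i)) B? (λ i → witness (suc i)) unique-suc
  split (yes p₀) = begin
    1 + ∑[ i < n ] 𝟙 (P? (suc i))  ≤⟨ +-monoʳ-≤ 1 (count-atMostOne (λ i → P? (suc i)) (no (λ ()))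
                                        (λ i pᵢ → fzero≢fsuc (unique zero (suc i) p₀ pᵢ)) unique-suc) ⟩
    1                              ≡⟨ 𝟙-⇔ (λ _ → witness zero p₀) (λ _ → p₀) (yes p₀) B? ⟩
    𝟙 B?                           ∎

∣p∣≡sum : ∀ {n} (p : Subset n) → ∣ p ∣ ≡ ∑[ i < n ] 𝟙 (i ∈? p)
∣p∣≡sum []            = refl
∣p∣≡sum (inside ∷ p)  = cong suc (trans (∣p∣≡sum p) (sum-cong-≗ (λ i → 𝟙-⇔ there drop-there (i ∈? p) _)))
∣p∣≡sum (outside ∷ p) = trans (∣p∣≡sum p) (sum-cong-≗ (λ i → 𝟙-⇔ there drop-there (i ∈? p) _))

select : ∀ {n} {P : Fin n → Set} → (∀ i → Dec (P i)) → Subset n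
select P? = tabulate (λ i → does (P? i))

select⁺ : ∀ {n} {P : Fin n → Set} (P? : ∀ i → Dec (P i)) {i} → P i → i ∈ select P?
select⁺ P? {i} pᵢ = lookup⇒[]= i (select P?) (trans (lookup∘tabulate _ i) (dec-true (P? i) pᵢ))

select⁻ : ∀ {n} {P : Fin n → Set} (P? : ∀ i → Dec (P i)) {i} → i ∈ select P? → P i
select⁻ P? {i} i∈ with P? i | trans (sym (lookup∘tabulate (λ j → does (P? j)) i)) ([]=⇒lookup i∈)
... | yes pᵢ | _  = pᵢ
... | no _   | ()

∣select∣ : ∀ {n} {P : Fin n → Set} (P? : ∀ i → Dec (P i)) → ∣ select P? ∣ ≡ ∑[ i < n ] 𝟙 (P? i)
∣select∣ P? = trans (∣p∣≡sum (select P?))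
  (sum-cong-≗ (λ i → 𝟙-⇔ (select⁻ P?) (select⁺ P?) (i ∈? select P?) (P? i)))

module Walks (X : Graph) where

  walk-++ : ∀ {u v w j k} → Walk X u v j → Walk X v w k → Walk X u w (j + k)
  walk-++ here       q = q
  walk-++ (step a p) q = step a (walk-++ p q)

  walk-snoc : ∀ {u v w k} → Walk X u v k → Adj X v w → Walk X u w (suc k)
  walk-snoc here       a = step a here
  walk-snoc (step b p) a = step b (walk-snoc p a)

  walk-reverse : ∀ {u v k} → Walk X u v k → Walk X v u k
  walk-reverse here       = here
  walk-reverse (step a p) = walk-snoc (walk-reverse p) (adj-sym X a)

AllDist : Graph → Set
AllDist X = ∀ u v → ∃[ k ] Dist X u v k

-- A strong resolving set records the distance of every pair it resolves, so
-- its mere existence provides all distances.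
resolving⇒AllDist : ∀ X S → StrongResolvingSet X S → AllDist X
resolving⇒AllDist X S R u v with R u v
... | _ , _ , _ , _ , c , _ , _ , uv , _ = c , uv

SR-or-equal : (X : Graph) → Fin (n X) → Fin (n X) → Set
SR-or-equal X u v = u ≡ v ⊎ Adj (SR X) u v

SR-or-equal-sym : ∀ X {u v} → SR-or-equal X u v → SR-or-equal X v u
SR-or-equal-sym X (inj₁ e)  = inj₁ (sym e)
SR-or-equal-sym X (inj₂ uv) = inj₂ (adj-sym (SR X) uv)

module Distance (X : Graph) (D : AllDist X) where
  open Walks X

  V : Set
  V = Fin (n X)

  d : V → V → ℕ
  d u v = proj₁ (D u v)

  geodesic : ∀ u v → Walk X u v (d u v)
  geodesic u v = proj₁ (proj₂ (D u v))

  d-minimal : ∀ u v {j} → Walk X u v j → d u v ≤ j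
  d-minimal u v = proj₂ (proj₂ (D u v)) _

  dist : ∀ u v → Dist X u v (d u v)
  dist u v = geodesic u v , λ _ → d-minimal u v

  dist-unique : ∀ {u v k} → Dist X u v k → k ≡ d u v
  dist-unique {u} {v} (w , min) = ≤-antisym (min _ (geodesic u v)) (d-minimal u v w)

  d-sym : ∀ u v → d u v ≡ d v u
  d-sym u v = ≤-antisym (d-minimal u v (walk-reverse (geodesic v u)))
                        (d-minimal v u (walk-reverse (geodesic u v)))

  d-triangle : ∀ u v w → d u w ≤ d u v + d v w
  d-triangle u v w = d-minimal u w (walk-++ (geodesic u v) (geodesic v w))

  d-refl : ∀ u → d u u ≡ 0
  d-refl u = n≤0⇒n≡0 (d-minimal u u here)

  d≡0⇒≡ : ∀ {u v} → d u v ≡ 0 → u ≡ v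
  d≡0⇒≡ {u} {v} e with d u v | geodesic u v
  d≡0⇒≡ refl | .0 | here = refl

  d-adjacent : ∀ {u v} → Adj X u v → d u v ≤ 1
  d-adjacent a = d-minimal _ _ (step a here)

  d-neighbour : ∀ {u u'} w → Adj X u u' → d w u' ≤ suc (d w u)
  d-neighbour {u} {u'} w a = begin
    d w u'           ≤⟨ d-triangle w u u' ⟩
    d w u + d u u'   ≤⟨ +-monoʳ-≤ (d w u) (d-adjacent a) ⟩
    d w u + 1        ≡⟨ +-comm (d w u) 1 ⟩
    suc (d w u)      ∎
    where open ≤-Reasoning

  first-step : ∀ {u v} → u ≢ v → Σ V λ u' → Adj X u u' × suc (d u' v) ≤ d u v
  first-step {u} {v} u≢v with d u v | geodesic u v
  ... | .0     | here         = ⊥-elim (u≢v refl)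
  ... | suc k  | step a walk  = _ , a , s≤s (d-minimal _ v walk)

  d≢0 : ∀ {u v} → u ≢ v → 1 ≤ d u v
  d≢0 u≢v = ≤-trans (s≤s z≤n) (proj₂ (proj₂ (first-step u≢v)))

  MD : V → V → Set
  MD u v = ∀ w → Adj X u w → d v w ≤ d u v

  MaxDistant⇒MD : ∀ {u v} → MaxDistant X u v → MD u v
  MaxDistant⇒MD {u} {v} m w a = m w (d v w) (d u v) a (dist v w) (dist u v)

  MD⇒MaxDistant : ∀ {u v} → MD u v → MaxDistant X u v
  MD⇒MaxDistant m w _ _ adj vw uv rewrite dist-unique vw | dist-unique uv = m w adj

  SR-or-equal⇒MD : ∀ {u v} → SR-or-equal X u v → u ≡ v ⊎ MD u v
  SR-or-equal⇒MD = map₂ (λ { (_ , u-md , _) → MaxDistant⇒MD u-md })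

  MD-within : ∀ {s s' t M} → s ≡ s' ⊎ Adj X s s' → s ≡ t ⊎ MD s t → 1 ≤ M → d s t ≤ M → d t s' ≤ M
  MD-within {s} {s'} {t} (inj₁ refl) _ _ st≤M = ≤-trans (≤-reflexive (d-sym t s)) st≤M
  MD-within (inj₂ a) (inj₁ refl) 1≤M _    = ≤-trans (d-adjacent a) 1≤M
  MD-within (inj₂ a) (inj₂ md)   _   st≤M = ≤-trans (md _ a) st≤M

module StrongResolvingGraph (X : Graph) (D : AllDist X) where
  open Distance X D

  Resolves : V → V → V → Set
  Resolves w u v = d w u ≡ d w v + d u v ⊎ d w v ≡ d w u + d u v

  StronglyResolves⇒Resolves : ∀ {w u v} → StronglyResolves X w u v → Resolves w u v
  StronglyResolves⇒Resolves (_ , _ , _ , wu , wv , uv , inj₁ e)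
    rewrite dist-unique wu | dist-unique wv | dist-unique uv = inj₁ e
  StronglyResolves⇒Resolves (_ , _ , _ , wu , wv , uv , inj₂ e)
    rewrite dist-unique wu | dist-unique wv | dist-unique uv = inj₂ e

  Resolves⇒StronglyResolves : ∀ {w u v} → Resolves w u v → StronglyResolves X w u v
  Resolves⇒StronglyResolves {w} {u} {v} r = _ , _ , _ , dist w u , dist w v , dist u v , r

  -- A geodesic from w through v to u cannot start before v when v is
  -- maximally distant from u: the first step from v towards w would lead
  -- to a shorter route.
  geodesic-through-MD : ∀ w u v → d w u ≡ d w v + d u v → MD v u → w ≡ v
  geodesic-through-MD w u v e md with w ≟ᶠ v
  ... | yes w≡v = w≡v
  ... | no  w≢v with first-step {v} {w} (λ v≡w → w≢v (sym v≡w))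
  ...   | v' , a , closer = ⊥-elim (<⇒≱ shorter (≤-reflexive (sym e)))
    where
    shorter : d w u < d w v + d u v
    shorter = begin-strict
      d w u            ≤⟨ d-triangle w v' u ⟩
      d w v' + d v' u  ≡⟨ cong₂ _+_ (d-sym w v') (d-sym v' u) ⟩
      d v' w + d u v'  ≤⟨ +-monoʳ-≤ (d v' w) (md v' a) ⟩
      d v' w + d v u   <⟨ +-monoˡ-< (d v u) closer ⟩
      d v w + d v u    ≡⟨ cong₂ _+_ (d-sym v w) (d-sym v u) ⟩
      d w v + d u v    ∎
      where open ≤-Reasoning

  resolving-covers : ∀ S → StrongResolvingSet X S → ∀ u v → Adj (SR X) u v → u ∈ S ⊎ v ∈ S
  resolving-covers S R u v (_ , u-md , v-md) with R u v
  ... | w , w∈S , res with StronglyResolves⇒Resolves res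
  ...   | inj₁ e = inj₂ (subst (_∈ S) (geodesic-through-MD w u v e (MaxDistant⇒MD v-md)) w∈S)
  ...   | inj₂ e = inj₁ (subst (_∈ S) (geodesic-through-MD w v u (trans e (cong (d w u +_) (d-sym u v)))
                                        (MaxDistant⇒MD u-md)) w∈S)

  resolving⇒∁-independent : ∀ S → StrongResolvingSet X S → IndependentSet (SR X) (∁ S)
  resolving⇒∁-independent S R u v u∈ v∈ uv with resolving-covers S R u v uv
  ... | inj₁ u∈S = x∈∁p⇒x∉p u∈ u∈S
  ... | inj₂ v∈S = x∈∁p⇒x∉p v∈ v∈S

  OnGeodesic : V → V → V → V → Set
  OnGeodesic x u v y = d x y ≡ d x u + d u v + d v y

  on-geodesic-reverse : ∀ {x u v y} → OnGeodesic x u v y → OnGeodesic y v u x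
  on-geodesic-reverse {x} {u} {v} {y} e = begin
    d y x                    ≡⟨ d-sym y x ⟩
    d x y                    ≡⟨ e ⟩
    d x u + d u v + d v y    ≡⟨ reverse3 (d x u) (d u v) (d v y) ⟩
    d v y + d u v + d x u    ≡⟨ cong₂ _+_ (cong₂ _+_ (d-sym v y) (d-sym u v)) (d-sym x u) ⟩
    d y v + d v u + d u x    ∎
    where
    open ≡-Reasoning
    reverse3 : ∀ a b c → a + b + c ≡ c + b + a
    reverse3 = solve-∀

  on-geodesic-prefix : ∀ {x u v y} → OnGeodesic x u v y → d x v ≡ d x u + d u v
  on-geodesic-prefix {x} {u} {v} {y} e = ≤-antisym (d-triangle x u v)
    (+-cancelʳ-≤ (d v y) _ _ (≤-trans (≤-reflexive (sym e)) (d-triangle x v y)))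

  -- If x is a farthest end of geodesics x … u … v … y (y fixed), then x is
  -- maximally distant from y: a neighbour farther from y would extend them.
  farthest⇒MD : ∀ {u v x y} → OnGeodesic x u v y →
    (∀ x' → OnGeodesic x' u v y → d x' y ≤ d x y) → MD x y
  farthest⇒MD {u} {v} {x} {y} e farthest x' a with d y x' ≤? d x y
  ... | yes ≤d = ≤d
  ... | no  ≰d = ⊥-elim (<⇒≱ (≤-reflexive (sym x'y≡)) (farthest x' x'-on))
    where
    x'y≡ : d x' y ≡ suc (d x y)
    x'y≡ = trans (d-sym x' y) (≤-antisym (≤-trans (d-neighbour y a) (s≤s (≤-reflexive (d-sym y x)))) (≰⇒> ≰d))
    x'-on : OnGeodesic x' u v y
    x'-on = ≤-antisym
      (begin
        d x' y                    ≤⟨ d-triangle x' u y ⟩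
        d x' u + d u y            ≤⟨ +-monoʳ-≤ (d x' u) (d-triangle u v y) ⟩
        d x' u + (d u v + d v y)  ≡⟨ +-assoc (d x' u) (d u v) (d v y) ⟨
        d x' u + d u v + d v y    ∎)
      (begin
        d x' u + d u v + d v y    ≤⟨ +-monoˡ-≤ (d v y) (+-monoˡ-≤ (d u v) x'u≤) ⟩
        suc (d x u + d u v + d v y) ≡⟨ cong suc e ⟨
        suc (d x y)               ≡⟨ x'y≡ ⟨
        d x' y                    ∎)
      where
      open ≤-Reasoning
      x'u≤ : d x' u ≤ suc (d x u)
      x'u≤ = begin
        d x' u       ≡⟨ d-sym x' u ⟩
        d u x'       ≤⟨ d-neighbour u a ⟩
        suc (d u x)  ≡⟨ cong suc (d-sym u x) ⟩
        suc (d x u)  ∎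

  -- Among all geodesics x … u … v … y, choose one with d x y maximal; both of
  -- its ends are then maximally distant from each other.
  module FarthestPair (u v : V) where
    OnGeodesic? : (p : V × V) → Dec (OnGeodesic (proj₁ p) u v (proj₂ p))
    OnGeodesic? (x , y) = d x y ≟ d x u + d u v + d v y

    pairs : List (V × V)
    pairs = cartesianProduct (allFin (n X)) (allFin (n X))

    candidates : List (V × V)
    candidates = filter OnGeodesic? pairs

    length-of : V × V → ℕ
    length-of (x , y) = d x y

    trivial : OnGeodesic u u v v
    trivial rewrite d-refl u | d-refl v = sym (+-identityʳ (d u v))

    ends : V × V
    ends = argmax length-of (u , v) candidates

    x y : V
    x = proj₁ ends
    y = proj₂ ends

    ends-on : OnGeodesic x u v y
    ends-on = argmax-all length-of trivial (all-filter OnGeodesic? pairs)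

    ends-farthest : ∀ x' y' → OnGeodesic x' u v y' → d x' y' ≤ d x y
    ends-farthest x' y' on = All.lookup (f[xs]≤f[argmax] (u , v) candidates)
      (∈-filter⁺ OnGeodesic? (∈-cartesianProduct⁺ (∈-allFin x') (∈-allFin y')) on)

    x-MD : MD x y
    x-MD = farthest⇒MD ends-on (λ x' on → ends-farthest x' y on)

    y-MD : MD y x
    y-MD = farthest⇒MD (on-geodesic-reverse ends-on) λ y' on →
      begin
        d y' x ≡⟨ d-sym y' x ⟩
        d x y' ≤⟨ ends-farthest x y' (on-geodesic-reverse on) ⟩
        d x y  ≡⟨ d-sym x y ⟩
        d y x  ∎
      where open ≤-Reasoning

    x-resolves : Resolves x u v
    x-resolves = inj₂ (on-geodesic-prefix ends-on)

    y-resolves : Resolves y u v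
    y-resolves = inj₁ (trans (on-geodesic-prefix (on-geodesic-reverse ends-on)) (cong (d y v +_) (d-sym v u)))

    ends-distinct : u ≢ v → x ≢ y
    ends-distinct u≢v x≡y = u≢v (d≡0⇒≡ (n≤0⇒n≡0 (begin
      d u v                  ≤⟨ m≤n+m (d u v) (d x u) ⟩
      d x u + d u v          ≤⟨ m≤m+n _ (d v y) ⟩
      d x u + d u v + d v y  ≡⟨ ends-on ⟨
      d x y                  ≡⟨ cong (d x) x≡y ⟨
      d x x                  ≡⟨ d-refl x ⟩
      0                      ∎)))
      where open ≤-Reasoning

  Covers : Subset (n X) → Set
  Covers S = ∀ u v → Adj (SR X) u v → u ∈ S ⊎ v ∈ S

  -- A vertex cover of X_SR strongly resolves every pair u ≠ v: it contains
  -- an end of the farthest geodesic through u and v.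
  covering-resolves : ∀ S → Covers S → ∀ u v → u ≢ v → ∃[ w ] (w ∈ S × StronglyResolves X w u v)
  covering-resolves S covers u v u≢v =
    [ (λ x∈S → x , x∈S , Resolves⇒StronglyResolves x-resolves)
    , (λ y∈S → y , y∈S , Resolves⇒StronglyResolves y-resolves)
    ]′ (covers x y (ends-distinct u≢v , MD⇒MaxDistant x-MD , MD⇒MaxDistant y-MD))
    where open FarthestPair u v

  -- For n ≥ 2 such a set is nonempty, so it also resolves the pairs u, u.
  covering⇒resolving : ∀ S → 2 ≤ n X → Covers S → StrongResolvingSet X S
  covering⇒resolving S (s≤s (s≤s _)) covers u v with u ≟ᶠ v
  ... | no u≢v = covering-resolves S covers u v u≢v
  ... | yes refl with covering-resolves S covers zero (suc zero) (λ ())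
  ...   | w , w∈S , _ = w , w∈S , Resolves⇒StronglyResolves (inj₁ (begin
    d w u          ≡⟨ +-identityʳ (d w u) ⟨
    d w u + 0      ≡⟨ cong (d w u +_) (d-refl u) ⟨
    d w u + d u u  ∎))
    where open ≡-Reasoning

  independent⇒∁-covers : ∀ J → IndependentSet (SR X) J → Covers (∁ J)
  independent⇒∁-covers J independent u v uv with u ∈? J | v ∈? J
  ... | no u∉J  | _       = inj₁ (x∉p⇒x∈∁p u∉J)
  ... | yes _   | no v∉J  = inj₂ (x∉p⇒x∈∁p v∉J)
  ... | yes u∈J | yes v∈J = ⊥-elim (independent u v u∈J v∈J uv)

independence-number-unique : ∀ X {a b} → IsIndependenceNumber X a → IsIndependenceNumber X b → a ≡ b
independence-number-unique X ((A , A-ind , ∣A∣) , a-max) ((B , B-ind , ∣B∣) , b-max) =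
  ≤-antisym (subst (_≤ _) ∣A∣ (b-max A A-ind)) (subst (_≤ _) ∣B∣ (a-max B B-ind))

-- Complements of strong resolving sets are exactly the independent sets of
-- X_SR, so β(X_SR) = n − dim_s(X).
β-from-dim : ∀ X {k} → 2 ≤ n X → IsStrongMetricDim X k → IsIndependenceNumber (SR X) (n X ∸ k)
β-from-dim X {k} two ((S , S-resolving , ∣S∣) , minimal) =
  (∁ S , resolving⇒∁-independent S S-resolving , trans (∣∁p∣≡n∸∣p∣ S) (cong (n X ∸_) ∣S∣)) ,
  λ J J-independent → m+n≤o⇒m≤o∸n ∣ J ∣ (begin
    ∣ J ∣ + k  ≡⟨ +-comm ∣ J ∣ k ⟩
    k + ∣ J ∣  ≤⟨ m≤o∸n⇒m+n≤o k (∣p∣≤n J) (subst (k ≤_) (∣∁p∣≡n∸∣p∣ J)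
                   (minimal (∁ J) (covering⇒resolving (∁ J) two (independent⇒∁-covers J J-independent)))) ⟩
    n X        ∎)
  where
  open StrongResolvingGraph X (resolving⇒AllDist X S S-resolving)
  open ≤-Reasoning

dim+β≡n : ∀ X {k β} → 2 ≤ n X → IsStrongMetricDim X k → IsIndependenceNumber (SR X) β → k + β ≡ n X
dim+β≡n X {k} {β} two dim@((S , _ , ∣S∣) , _) β-indep = begin
  k + β         ≡⟨ cong (k +_) (independence-number-unique (SR X) β-indep (β-from-dim X two dim)) ⟩
  k + (n X ∸ k) ≡⟨ m+[n∸m]≡n (subst (_≤ n X) ∣S∣ (∣p∣≤n S)) ⟩
  n X           ∎
  where open ≡-Reasoning

module StrongProduct (G H : Graph) (DG : AllDist G) (DH : AllDist H) where
  module Gd = Distance G DG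
  module Hd = Distance H DH

  P : Graph
  P = G ⊠ H

  VP : Set
  VP = Fin (n G * n H)

  π₁ : VP → Fin (n G)
  π₁ x = proj₁ (remQuot {n G} (n H) x)

  π₂ : VP → Fin (n H)
  π₂ x = proj₂ (remQuot {n G} (n H) x)

  ⟨_,_⟩ : Fin (n G) → Fin (n H) → VP
  ⟨ a , b ⟩ = combine a b

  π₁-⟨⟩ : ∀ a b → π₁ ⟨ a , b ⟩ ≡ a
  π₁-⟨⟩ a b = cong proj₁ (remQuot-combine a b)

  π₂-⟨⟩ : ∀ a b → π₂ ⟨ a , b ⟩ ≡ b
  π₂-⟨⟩ a b = cong proj₂ (remQuot-combine a b)

  ⟨π₁,π₂⟩ : ∀ x → ⟨ π₁ x , π₂ x ⟩ ≡ x
  ⟨π₁,π₂⟩ x = combine-remQuot {n G} (n H) x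

  StrongAdjCoords : Fin (n G) × Fin (n H) → Fin (n G) × Fin (n H) → Set
  StrongAdjCoords (a , b) (c , e) = (a ≡ c × Adj H b e) ⊎ (Adj G a c × b ≡ e) ⊎ (Adj G a c × Adj H b e)

  adj-⟨⟩ : ∀ {a b c e} → StrongAdjCoords (a , b) (c , e) → Adj P ⟨ a , b ⟩ ⟨ c , e ⟩
  adj-⟨⟩ {a} {b} {c} {e} = subst₂ StrongAdjCoords (sym (remQuot-combine a b)) (sym (remQuot-combine c e))

  adj-π₁ : ∀ {x y} → Adj P x y → π₁ x ≡ π₁ y ⊎ Adj G (π₁ x) (π₁ y)
  adj-π₁ (inj₁ (e , _))        = inj₁ e
  adj-π₁ (inj₂ (inj₁ (a , _))) = inj₂ a
  adj-π₁ (inj₂ (inj₂ (a , _))) = inj₂ a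

  adj-π₂ : ∀ {x y} → Adj P x y → π₂ x ≡ π₂ y ⊎ Adj H (π₂ x) (π₂ y)
  adj-π₂ (inj₁ (_ , a))        = inj₂ a
  adj-π₂ (inj₂ (inj₁ (_ , e))) = inj₁ e
  adj-π₂ (inj₂ (inj₂ (_ , a))) = inj₂ a

  shadow : ∀ (X : Graph) (π : VP → Fin (n X)) → (∀ {x y} → Adj P x y → π x ≡ π y ⊎ Adj X (π x) (π y)) →
    ∀ {x y k} → Walk P x y k → Σ ℕ λ j → j ≤ k × Walk X (π x) (π y) j
  shadow X π adj-π here = 0 , z≤n , here
  shadow X π adj-π (step a walk) with adj-π a | shadow X π adj-π walk
  ... | inj₁ e | j , j≤k , walk' = j , m≤n⇒m≤1+n j≤k , subst (λ t → Walk X t (π _) j) (sym e) walk'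
  ... | inj₂ a' | j , j≤k , walk' = suc j , s≤s j≤k , step a' walk'

  -- Walking both coordinates simultaneously, the shorter one waits at its end.
  lift : ∀ {a c b e p q} → Walk G a c p → Walk H b e q → Walk P ⟨ a , b ⟩ ⟨ c , e ⟩ (p ⊔ q)
  lift here         here         = here
  lift here         (step h wH)  = step (adj-⟨⟩ (inj₁ (refl , h))) (lift here wH)
  lift {p = suc p} (step g wG) here =
    step (adj-⟨⟩ (inj₂ (inj₁ (g , refl)))) (subst (Walk P _ _) (⊔-identityʳ p) (lift wG here))
  lift (step g wG) (step h wH)  = step (adj-⟨⟩ (inj₂ (inj₂ (g , h)))) (lift wG wH)

  dist-⊠ : ∀ x y → Dist P x y (Gd.d (π₁ x) (π₁ y) ⊔ Hd.d (π₂ x) (π₂ y))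
  dist-⊠ x y = product-geodesic , λ _ walk →
    ⊔-lub (shortest (Gd.d-minimal _ _) (shadow G π₁ adj-π₁ walk))
          (shortest (Hd.d-minimal _ _) (shadow H π₂ adj-π₂ walk))
    where
    shortest : ∀ {X : Graph} {s t k m} → (∀ {j} → Walk X s t j → m ≤ j) →
      Σ ℕ (λ j → j ≤ k × Walk X s t j) → m ≤ k
    shortest minimal (j , j≤k , walk) = ≤-trans (minimal walk) j≤k

    product-geodesic : Walk P x y (Gd.d (π₁ x) (π₁ y) ⊔ Hd.d (π₂ x) (π₂ y))
    product-geodesic = subst₂ (λ s t → Walk P s t (Gd.d (π₁ x) (π₁ y) ⊔ Hd.d (π₂ x) (π₂ y)))
      (⟨π₁,π₂⟩ x) (⟨π₁,π₂⟩ y) (lift (Gd.geodesic _ _) (Hd.geodesic _ _))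

  DP : AllDist P
  DP x y = _ , dist-⊠ x y

  module Pd = Distance P DP


  coordinates-MD⇒MD : ∀ x y → π₁ x ≡ π₁ y ⊎ Gd.MD (π₁ x) (π₁ y) → π₂ x ≡ π₂ y ⊎ Hd.MD (π₂ x) (π₂ y) →
    x ≢ y → Pd.MD x y
  coordinates-MD⇒MD x y md₁ md₂ x≢y x' a = ⊔-lub
    (Gd.MD-within (adj-π₁ a) md₁ (Pd.d≢0 x≢y) (m≤m⊔n _ _))
    (Hd.MD-within (adj-π₂ a) md₂ (Pd.d≢0 x≢y) (m≤n⊔m _ _))

  -- If x is maximally distant from y and the first coordinates realise the
  -- distance, then x₁ is maximally distant from y₁ (move x₁ alone).
  MD⇒MD₁ : ∀ x y → Pd.MD x y → Hd.d (π₂ x) (π₂ y) ≤ Gd.d (π₁ x) (π₁ y) → Gd.MD (π₁ x) (π₁ y)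
  MD⇒MD₁ x y md dᴴ≤dᴳ a' a = begin
    Gd.d (π₁ y) a'                  ≡⟨ cong (Gd.d (π₁ y)) (π₁-⟨⟩ a' (π₂ x)) ⟨
    Gd.d (π₁ y) (π₁ x')             ≤⟨ m≤m⊔n _ _ ⟩
    Pd.d y x'                       ≤⟨ md x' x~x' ⟩
    Pd.d x y                        ≡⟨ m≥n⇒m⊔n≡m dᴴ≤dᴳ ⟩
    Gd.d (π₁ x) (π₁ y)              ∎
    where
    open ≤-Reasoning
    x' = ⟨ a' , π₂ x ⟩
    x~x' : Adj P x x'
    x~x' = subst (λ z → Adj P z x') (⟨π₁,π₂⟩ x) (adj-⟨⟩ (inj₂ (inj₁ (a , refl))))

  MD⇒MD₂ : ∀ x y → Pd.MD x y → Gd.d (π₁ x) (π₁ y) ≤ Hd.d (π₂ x) (π₂ y) → Hd.MD (π₂ x) (π₂ y)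
  MD⇒MD₂ x y md dᴳ≤dᴴ b' b = begin
    Hd.d (π₂ y) b'                  ≡⟨ cong (Hd.d (π₂ y)) (π₂-⟨⟩ (π₁ x) b') ⟨
    Hd.d (π₂ y) (π₂ x')             ≤⟨ m≤n⊔m _ _ ⟩
    Pd.d y x'                       ≤⟨ md x' x~x' ⟩
    Pd.d x y                        ≡⟨ m≤n⇒m⊔n≡n dᴳ≤dᴴ ⟩
    Hd.d (π₂ x) (π₂ y)              ∎
    where
    open ≤-Reasoning
    x' = ⟨ π₁ x , b' ⟩
    x~x' : Adj P x x'
    x~x' = subst (λ z → Adj P z x') (⟨π₁,π₂⟩ x) (adj-⟨⟩ (inj₁ (refl , b)))

  -- An edge of (G ⊠ H)_SR projects to an edge of G_SR or of H_SR, namely in the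
  -- coordinate realising the distance.
  SR-project : ∀ {x y} → Adj (SR P) x y → Adj (SR G) (π₁ x) (π₁ y) ⊎ Adj (SR H) (π₂ x) (π₂ y)
  SR-project {x} {y} (x≢y , x-md , y-md) with Hd.d (π₂ x) (π₂ y) ≤? Gd.d (π₁ x) (π₁ y)
  ... | yes dᴴ≤dᴳ = inj₁ (x₁≢y₁ , Gd.MD⇒MaxDistant (MD⇒MD₁ x y (Pd.MaxDistant⇒MD x-md) dᴴ≤dᴳ)
                                , Gd.MD⇒MaxDistant (MD⇒MD₁ y x (Pd.MaxDistant⇒MD y-md) dᴴ≤dᴳ'))
    where
    dᴴ≤dᴳ' : Hd.d (π₂ y) (π₂ x) ≤ Gd.d (π₁ y) (π₁ x)
    dᴴ≤dᴳ' = subst₂ _≤_ (Hd.d-sym _ _) (Gd.d-sym _ _) dᴴ≤dᴳ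
    x₁≢y₁ : π₁ x ≢ π₁ y
    x₁≢y₁ e = x≢y (trans (sym (⟨π₁,π₂⟩ x)) (trans (cong₂ ⟨_,_⟩ e x₂≡y₂) (⟨π₁,π₂⟩ y)))
      where
      x₂≡y₂ : π₂ x ≡ π₂ y
      x₂≡y₂ = Hd.d≡0⇒≡ (n≤0⇒n≡0 (≤-trans dᴴ≤dᴳ
                (≤-reflexive (trans (cong (Gd.d (π₁ x)) (sym e)) (Gd.d-refl _)))))
  ... | no dᴴ≰dᴳ = inj₂ (x₂≢y₂ , Hd.MD⇒MaxDistant (MD⇒MD₂ x y (Pd.MaxDistant⇒MD x-md) dᴳ≤dᴴ)
                                , Hd.MD⇒MaxDistant (MD⇒MD₂ y x (Pd.MaxDistant⇒MD y-md) dᴳ≤dᴴ'))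
    where
    dᴳ<dᴴ : Gd.d (π₁ x) (π₁ y) < Hd.d (π₂ x) (π₂ y)
    dᴳ<dᴴ = ≰⇒> dᴴ≰dᴳ
    dᴳ≤dᴴ = <⇒≤ dᴳ<dᴴ
    dᴳ≤dᴴ' : Gd.d (π₁ y) (π₁ x) ≤ Hd.d (π₂ y) (π₂ x)
    dᴳ≤dᴴ' = subst₂ _≤_ (Gd.d-sym _ _) (Hd.d-sym _ _) dᴳ≤dᴴ
    x₂≢y₂ : π₂ x ≢ π₂ y
    x₂≢y₂ e = <⇒≱ dᴳ<dᴴ (≤-trans (≤-reflexive (trans (cong (Hd.d (π₂ x)) (sym e)) (Hd.d-refl _))) z≤n)

  SR-lift : ∀ {a b a' b'} → SR-or-equal G a a' → SR-or-equal H b b' → ⟨ a , b ⟩ ≢ ⟨ a' , b' ⟩ →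
    Adj (SR P) ⟨ a , b ⟩ ⟨ a' , b' ⟩
  SR-lift {a} {b} {a'} {b'} aa' bb' x≢y =
    x≢y , Pd.MD⇒MaxDistant (coordinates-MD⇒MD _ _ (md₁ aa') (md₂ bb') x≢y)
        , Pd.MD⇒MaxDistant (coordinates-MD⇒MD _ _ (md₁ (SR-or-equal-sym G aa')) (md₂ (SR-or-equal-sym H bb'))
                                              (λ e → x≢y (sym e)))
    where
    md₁ : ∀ {a a' b b'} → SR-or-equal G a a' →
      π₁ ⟨ a , b ⟩ ≡ π₁ ⟨ a' , b' ⟩ ⊎ Gd.MD (π₁ ⟨ a , b ⟩) (π₁ ⟨ a' , b' ⟩)
    md₁ {a} {a'} {b} {b'} rewrite π₁-⟨⟩ a b | π₁-⟨⟩ a' b' = Gd.SR-or-equal⇒MD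
    md₂ : ∀ {a a' b b'} → SR-or-equal H b b' →
      π₂ ⟨ a , b ⟩ ≡ π₂ ⟨ a' , b' ⟩ ⊎ Hd.MD (π₂ ⟨ a , b ⟩) (π₂ ⟨ a' , b' ⟩)
    md₂ {a} {a'} {b} {b'} rewrite π₂-⟨⟩ a b | π₂-⟨⟩ a' b' = Hd.SR-or-equal⇒MD

  in-⊗? : ∀ I J (x : VP) → Dec (π₁ x ∈ I × π₂ x ∈ J)
  in-⊗? I J x = (π₁ x ∈? I) ×-dec (π₂ x ∈? J)

  _⊗_ : Subset (n G) → Subset (n H) → Subset (n G * n H)
  I ⊗ J = select (in-⊗? I J)

  ∣⊗∣ : ∀ I J → ∣ I ⊗ J ∣ ≡ ∣ I ∣ * ∣ J ∣
  ∣⊗∣ I J = begin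
    ∣ I ⊗ J ∣
      ≡⟨ ∣select∣ (in-⊗? I J) ⟩
    ∑[ x < n G * n H ] 𝟙 (in-⊗? I J x)
      ≡⟨ sum-combine (n G) (n H) (λ x → 𝟙 (in-⊗? I J x)) ⟩
    ∑[ a < n G ] ∑[ b < n H ] 𝟙 ((π₁ ⟨ a , b ⟩ ∈? I) ×-dec (π₂ ⟨ a , b ⟩ ∈? J))
      ≡⟨ sum-cong-≗ (λ a → sum-cong-≗ (λ b → factor a b)) ⟩
    ∑[ a < n G ] ∑[ b < n H ] (𝟙 (a ∈? I) * 𝟙 (b ∈? J))
      ≡⟨ sum-cong-≗ (λ a → *-distribˡ-sum {n H} (𝟙 (a ∈? I)) (λ b → 𝟙 (b ∈? J))) ⟨
    ∑[ a < n G ] (𝟙 (a ∈? I) * ∑[ b < n H ] 𝟙 (b ∈? J))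
      ≡⟨ *-distribʳ-sum {n G} (∑[ b < n H ] 𝟙 (b ∈? J)) (λ a → 𝟙 (a ∈? I)) ⟨
    ∑[ a < n G ] 𝟙 (a ∈? I) * ∑[ b < n H ] 𝟙 (b ∈? J)
      ≡⟨ cong₂ _*_ (∣p∣≡sum I) (∣p∣≡sum J) ⟨
    ∣ I ∣ * ∣ J ∣
      ∎
    where
    open ≡-Reasoning
    factor : ∀ a b → 𝟙 ((π₁ ⟨ a , b ⟩ ∈? I) ×-dec (π₂ ⟨ a , b ⟩ ∈? J)) ≡ 𝟙 (a ∈? I) * 𝟙 (b ∈? J)
    factor a b = trans (𝟙-× (π₁ ⟨ a , b ⟩ ∈? I) (π₂ ⟨ a , b ⟩ ∈? J)) (cong₂ _*_
      (𝟙-⇔ (subst (_∈ I) (π₁-⟨⟩ a b)) (subst (_∈ I) (sym (π₁-⟨⟩ a b))) (π₁ ⟨ a , b ⟩ ∈? I) (a ∈? I))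
      (𝟙-⇔ (subst (_∈ J) (π₂-⟨⟩ a b)) (subst (_∈ J) (sym (π₂-⟨⟩ a b))) (π₂ ⟨ a , b ⟩ ∈? J) (b ∈? J)))

  ∈⊗ : ∀ {I J x} → x ∈ I ⊗ J → π₁ x ∈ I × π₂ x ∈ J
  ∈⊗ {I} {J} = select⁻ (in-⊗? I J)

  ⊗-independent : ∀ I J → IndependentSet (SR G) I → IndependentSet (SR H) J → IndependentSet (SR P) (I ⊗ J)
  ⊗-independent I J I-ind J-ind x y x∈ y∈ xy with SR-project xy
  ... | inj₁ xy₁ = I-ind _ _ (proj₁ (∈⊗ x∈)) (proj₁ (∈⊗ y∈)) xy₁
  ... | inj₂ xy₂ = J-ind _ _ (proj₂ (∈⊗ x∈)) (proj₂ (∈⊗ y∈)) xy₂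

  -- Cutting an independent set I of (G ⊠ H)_SR along a partition of V(G)
  -- into k cliques of G_SR: over each clique, I projects to an independent set of
  -- H_SR, injectively.  Hence |I| ≤ k · β(H_SR).
  module Slices {k} (block : Fin (n G) → Fin k)
                (clique : ∀ a a' → block a ≡ block a' → a ≢ a' → Adj (SR G) a a')
                (I : Subset (n G * n H)) (I-independent : IndependentSet (SR P) I) where

    InSlice : Fin k → Fin (n H) → Fin (n G) → Set
    InSlice t b a = block a ≡ t × ⟨ a , b ⟩ ∈ I

    in-slice? : ∀ t b a → Dec (InSlice t b a)
    in-slice? t b a = (block a ≟ᶠ t) ×-dec (⟨ a , b ⟩ ∈? I)

    -- The second coordinates of the vertices of I lying over block t.
    slice : Fin k → Subset (n H)
    slice t = select (λ b → any? (in-slice? t b))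

    same-block : ∀ {a a'} → block a ≡ block a' → SR-or-equal G a a'
    same-block {a} {a'} e with a ≟ᶠ a'
    ... | yes a≡a' = inj₁ a≡a'
    ... | no  a≢a' = inj₂ (clique a a' e a≢a')

    slice-unique : ∀ t b a a' → InSlice t b a → InSlice t b a' → a ≡ a'
    slice-unique t b a a' (a∈t , x∈I) (a'∈t , y∈I) with a ≟ᶠ a'
    ... | yes a≡a' = a≡a'
    ... | no  a≢a' = ⊥-elim (I-independent _ _ x∈I y∈I
          (SR-lift (inj₂ (clique a a' (trans a∈t (sym a'∈t)) a≢a')) (inj₁ refl)
                   (λ e → a≢a' (combine-injectiveˡ a b a' b e))))

    slice-independent : ∀ t → IndependentSet (SR H) (slice t)
    slice-independent t b b' b∈ b'∈ bb' with select⁻ (λ b → any? (in-slice? t b)) b∈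
                                          | select⁻ (λ b → any? (in-slice? t b)) b'∈
    ... | a , a∈t , x∈I | a' , a'∈t , y∈I = I-independent _ _ x∈I y∈I
          (SR-lift (same-block (trans a∈t (sym a'∈t))) (inj₂ bb')
                   (λ e → proj₁ bb' (combine-injectiveʳ a b a' b' e)))

    ∣I∣≤∑∣slice∣ : ∣ I ∣ ≤ ∑[ t < k ] ∣ slice t ∣
    ∣I∣≤∑∣slice∣ = begin
      ∣ I ∣                                                   ≡⟨ ∣p∣≡sum I ⟩
      ∑[ x < n G * n H ] 𝟙 (x ∈? I)                           ≡⟨ sum-combine (n G) (n H) (λ x → 𝟙 (x ∈? I)) ⟩
      ∑[ a < n G ] ∑[ b < n H ] 𝟙 (⟨ a , b ⟩ ∈? I)            ≡⟨ ∑-comm (λ a b → 𝟙 (⟨ a , b ⟩ ∈? I)) ⟩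
      ∑[ b < n H ] ∑[ a < n G ] 𝟙 (⟨ a , b ⟩ ∈? I)
        ≡⟨ sum-cong-≗ (λ b → sum-fibres block (λ a → 𝟙 (⟨ a , b ⟩ ∈? I))) ⟩
      ∑[ b < n H ] ∑[ t < k ] ∑[ a < n G ] (𝟙 (block a ≟ᶠ t) * 𝟙 (⟨ a , b ⟩ ∈? I))
        ≡⟨ ∑-comm (λ b t → ∑[ a < n G ] (𝟙 (block a ≟ᶠ t) * 𝟙 (⟨ a , b ⟩ ∈? I))) ⟩
      ∑[ t < k ] ∑[ b < n H ] ∑[ a < n G ] (𝟙 (block a ≟ᶠ t) * 𝟙 (⟨ a , b ⟩ ∈? I))
        ≡⟨ sum-cong-≗ (λ t → sum-cong-≗ (λ b → sum-cong-≗ (λ a → 𝟙-× (block a ≟ᶠ t) (⟨ a , b ⟩ ∈? I)))) ⟨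
      ∑[ t < k ] ∑[ b < n H ] ∑[ a < n G ] 𝟙 (in-slice? t b a)
        ≤⟨ sum-mono-≤ (λ t → sum-mono-≤ (λ b → count-atMostOne (in-slice? t b) (b ∈? slice t)
             (λ a p → select⁺ (λ b → any? (in-slice? t b)) (a , p)) (slice-unique t b))) ⟩
      ∑[ t < k ] ∑[ b < n H ] 𝟙 (b ∈? slice t)                ≡⟨ sum-cong-≗ (λ t → ∣p∣≡sum (slice t)) ⟨
      ∑[ t < k ] ∣ slice t ∣                                  ∎
      where open ≤-Reasoning

  β-⊠ : ∀ {β₁ β₂} → IsIndependenceNumber (SR G) β₁ → CliquePartition (SR G) β₁ →
    IsIndependenceNumber (SR H) β₂ → IsIndependenceNumber (SR P) (β₁ * β₂)
  β-⊠ {β₁} {β₂} ((I , I-ind , ∣I∣) , _) (block , _ , clique) ((J , J-ind , ∣J∣) , J-max) =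
    (I ⊗ J , ⊗-independent I J I-ind J-ind , trans (∣⊗∣ I J) (cong₂ _*_ ∣I∣ ∣J∣)) ,
    λ K K-ind → let open Slices block clique K K-ind in begin
      ∣ K ∣                   ≤⟨ ∣I∣≤∑∣slice∣ ⟩
      ∑[ t < β₁ ] ∣ slice t ∣ ≤⟨ sum-mono-≤ (λ t → J-max (slice t) (slice-independent t)) ⟩
      ∑[ t < β₁ ] β₂          ≡⟨ sum-const β₁ β₂ ⟩
      β₁ * β₂                 ∎
    where open ≤-Reasoning

dimension-arithmetic : ∀ {k kG kH β₁ β₂ n₁ n₂} → kG + β₁ ≡ n₁ → kH + β₂ ≡ n₂ → k + β₁ * β₂ ≡ n₁ * n₂ →
  k + kG * kH ≡ n₂ * kG + n₁ * kH
dimension-arithmetic {k} {kG} {kH} {β₁} {β₂} refl refl e = +-cancelʳ-≡ (β₁ * β₂) _ _ (begin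
  k + kG * kH + β₁ * β₂                                ≡⟨ swap-last k (kG * kH) (β₁ * β₂) ⟩
  k + β₁ * β₂ + kG * kH                                ≡⟨ cong (_+ kG * kH) e ⟩
  (kG + β₁) * (kH + β₂) + kG * kH                      ≡⟨ expand kG kH β₁ β₂ ⟩
  (kH + β₂) * kG + (kG + β₁) * kH + β₁ * β₂            ∎)
  where
  open ≡-Reasoning
  swap-last : ∀ a b c → a + b + c ≡ a + c + b
  swap-last = solve-∀
  expand : ∀ a b c e → (a + c) * (b + e) + a * b ≡ (b + e) * a + (a + c) * b + c * e
  expand = solve-∀

theorem15 : (G H : Graph) → Connected G → Connected H → 2 ≤ n G → 2 ≤ n H →
    IsCGraph (SR G) →
    ∀ kG kH k → IsStrongMetricDim G kG → IsStrongMetricDim H kH →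
    IsStrongMetricDim (G ⊠ H) k →
    k + kG * kH ≡ n H * kG + n G * kH
theorem15 G H _ _ 2≤n₁ 2≤n₂ (β₁ , β₁-indep , partition) kG kH k
          dimG@((SG , RG , _) , _) dimH@((SH , RH , _) , _) dimP =
  dimension-arithmetic (dim+β≡n G 2≤n₁ dimG β₁-indep) (dim+β≡n H 2≤n₂ dimH β₂-indep)
                       (dim+β≡n (G ⊠ H) 2≤n₁n₂ dimP (β-⊠ β₁-indep partition β₂-indep))
  where
  open StrongProduct G H (resolving⇒AllDist G SG RG) (resolving⇒AllDist H SH RH)
  β₂-indep : IsIndependenceNumber (SR H) (n H ∸ kH)
  β₂-indep = β-from-dim H 2≤n₂ dimH
  2≤n₁n₂ : 2 ≤ n G * n H
  2≤n₁n₂ = *-mono-≤ 2≤n₁ (≤-trans (s≤s z≤n) 2≤n₂)
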